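{- For every polytope $P$ of dimension $d$, we have $\omega(P) \leqslant (d+1)^2$.
   Context: For a real matrix $M$, the rectangle graph $G(M)$ has as vertices the pairs $(i,j)$ with $M_{i,j}\neq 0$, two vertices $(i,j),(k,\ell)$ being adjacent iff $M_{i,\ell}=0$ or $M_{k,j}=0$. $\omega(M)$ denotes the clique number of $G(M)$ (a clique is also called a fooling set). A non-incidence matrix of a polytope $P$ is a 0/1-matrix whose rows are indexed by a set of faces of $P$ including all facets, whose columns are indexed by a set of nonempty faces of $P$ including all vertices, with entry $1$ at $(F,G)$ iff $F$ does not contain $G$. $\omega(P)$ is defined as $\omega(M)$ for any non-incidence matrix $M$ of $P$ (this is independent of the choice of $M$). -}

module Defs where

open import Level using (0ℓ)
open import Data.Nat using (ℕ; zero; suc)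
open import Data.Fin using (Fin)
open import Data.Product using (Σ; ∃; _×_; _,_; proj₁; proj₂)
open import Data.Sum using (_⊎_)
open import Relation.Nullary using (¬_)
open import Relation.Binary.PropositionalEquality using (_≡_; _≢_)
open import Relation.Binary.Structures using (IsTotalOrder)
open import Algebra.Structures using (IsCommutativeRing)
open import Function.Definitions using (Injective)

-- The real numbers, axiomatised as a Dedekind-complete ordered field
-- (unique up to isomorphism, so this is ℝ).

record RealField : Set₁ where
  infixl 6 _+_
  infixl 7 _*_
  infix  4 _≤_
  field
    R    : Set
    _+_  : R → R → R
    _*_  : R → R → R
    -_   : R → R
    0#   : R
    1#   : R
    _≤_  : R → R → Set
    isCommutativeRing : IsCommutativeRing _≡_ _+_ _*_ -_ 0# 1#
    0≢1     : 0# ≢ 1#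
    inverse : ∀ x → x ≢ 0# → ∃ λ y → x * y ≡ 1#
    isTotalOrder : IsTotalOrder _≡_ _≤_
    +-mono-≤ : ∀ x y z → x ≤ y → x + z ≤ y + z
    *-nonneg : ∀ x y → 0# ≤ x → 0# ≤ y → 0# ≤ x * y
    complete : (S : R → Set) → (∃ λ x → S x) → (∃ λ b → ∀ x → S x → x ≤ b) →
               ∃ λ s → (∀ x → S x → x ≤ s) × (∀ b → (∀ x → S x → x ≤ b) → s ≤ b)

-- Rectangle graph / fooling sets of a matrix with r rows and c columns,
-- given by the predicate "entry (i,j) is zero".
-- A clique of size k: k distinct nonzero positions, pairwise adjacent.

IsFoolingSet : {r c k : ℕ} (Zero : Fin r → Fin c → Set) →
               (Fin k → Fin r × Fin c) → Set
IsFoolingSet {k = k} Zero f =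
  Injective _≡_ _≡_ f ×
  (∀ s → ¬ Zero (proj₁ (f s)) (proj₂ (f s))) ×
  (∀ s t → s ≢ t →
     Zero (proj₁ (f s)) (proj₂ (f t)) ⊎ Zero (proj₁ (f t)) (proj₂ (f s)))

module Geometry (ℝ : RealField) where
  open RealField ℝ

  ∑ : (k : ℕ) → (Fin k → R) → R
  ∑ zero    f = 0#
  ∑ (suc k) f = f Fin.zero + ∑ k (λ i → f (Fin.suc i))

  Point : ℕ → Set
  Point n = Fin n → R

  _·_ : {n : ℕ} → Point n → Point n → R
  _·_ {n} a x = ∑ n (λ c → a c * x c)

  InConv : {n m : ℕ} → (Fin m → Point n) → Point n → Set
  InConv {n} {m} V x = ∃ λ (μ : Fin m → R) →
    (∀ i → 0# ≤ μ i) × (∑ m μ ≡ 1#) × (∀ c → x c ≡ ∑ m (λ i → μ i * V i c))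

  AffInd : {n k : ℕ} → (Fin k → Point n) → Set
  AffInd {n} {k} p = (μ : Fin k → R) → ∑ k μ ≡ 0# →
    (∀ c → ∑ k (λ i → μ i * p i c) ≡ 0#) → ∀ i → μ i ≡ 0#

  HasDim : {n : ℕ} → (Point n → Set) → ℕ → Set
  HasDim {n} S j =
    (∃ λ (p : Fin (suc j) → Point n) → (∀ i → S (p i)) × AffInd p) ×
    ((p : Fin (suc (suc j)) → Point n) → (∀ i → S (p i)) → ¬ AffInd p)

  -- DimPlus1 S e  :  dim S = e - 1   (e = 0 means S is empty, dim -1)
  DimPlus1 : {n : ℕ} → (Point n → Set) → ℕ → Set
  DimPlus1 {n} S zero    = (x : Point n) → ¬ S x
  DimPlus1 {n} S (suc j) = HasDim S j

  -- a face of P = conv V, given by a valid inequality a·x ≤ b;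
  -- the face is P ∩ {a·x = b}.  (a = 0, b = 0 gives P; a = 0, b = 1 gives ∅)
  Face : {n m : ℕ} → (Fin m → Point n) → Set
  Face {n} V = Σ (Point n × R) λ ab →
    (x : Point n) → InConv V x → proj₁ ab · x ≤ proj₂ ab

  InFace : {n m : ℕ} {V : Fin m → Point n} → Face V → Point n → Set
  InFace {V = V} ((a , b) , _) x = InConv V x × (a · x ≡ b)

  Contains : {n m : ℕ} {V : Fin m → Point n} → Face V → Face V → Set
  Contains {n} F G = (x : Point n) → InFace G x → InFace F x

  SameFace : {n m : ℕ} {V : Fin m → Point n} → Face V → Face V → Set
  SameFace F G = Contains F G × Contains G F

  PolytopeDim : {n m : ℕ} → (Fin m → Point n) → ℕ → Set
  PolytopeDim V d = DimPlus1 (InConv V) (suc d)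

  IsFacet : {n m : ℕ} {V : Fin m → Point n} → ℕ → Face V → Set
  IsFacet d F = DimPlus1 (InFace F) d

  IsVertex : {n m : ℕ} {V : Fin m → Point n} → Face V → Set
  IsVertex F = DimPlus1 (InFace F) 1

  record NonIncidenceMatrix {n m : ℕ} (V : Fin m → Point n) (d r c : ℕ) : Set where
    field
      row : Fin r → Face V
      col : Fin c → Face V
      row-distinct : ∀ i i' → SameFace (row i) (row i') → i ≡ i'
      col-distinct : ∀ j j' → SameFace (col j) (col j') → j ≡ j'
      col-nonempty : ∀ j → ∃ λ x → InFace (col j) x
      rows-facets  : (F : Face V) → IsFacet d F → ∃ λ i → SameFace (row i) F
      cols-vertices : (G : Face V) → IsVertex G → ∃ λ j → SameFace (col j) G

    Zero : Fin r → Fin c → Set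
    Zero i j = Contains (row i) (col j)

module Submission where

-- Fix d + 1 affinely independent points p of P. For the t-th pair (Fₜ, Gₜ) of the fooling
-- set take yₜ ∈ Gₜ off the hyperplane of Fₜ and an affine dependency μₜ of yₜ, p with
-- μₜ(yₜ) ≠ 0. Evaluating the slack of Fₛ along this dependency gives
-- μₜ(yₜ) · slackₛ(yₜ) = − ⟨μₜ|p , slackₛ ∘ p⟩, so the k × k matrix ⟨μₜ|p , slackₛ ∘ p⟩ has
-- rank ≤ d + 1, a nonzero diagonal and the zero pattern of the fooling set; its Hadamard
-- product with its transpose is diagonal and nonsingular of rank ≤ (d + 1)², whence
-- k ≤ (d + 1)².
-- The reals are only axiomatised, so equality of reals is not decidable: the argument runs in
-- the double-negation monad, ¬¬-stability of ≤ being a consequence of completeness, and the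
-- decidable conclusion is recovered at the end.

open import Defs
open import Data.Nat using (ℕ; suc; _≤_; _^_)
open import Data.Fin using (Fin)
open import Data.Product using (_×_)

open import Level using (0ℓ)
open import Function using (_∘_)
open import Data.Nat as ℕ using (zero; z≤n; s≤s; _≤?_)
open import Data.Nat.Properties using (m≤n⇒m≤1+n; *-identityʳ)
open import Data.Fin using (zero; suc; punchIn; combine; remQuot; _↑ˡ_; _↑ʳ_)
open import Data.Fin.Properties using (punchIn-injective; punchInᵢ≢i; remQuot-combine)
open import Data.Vec.Functional using (Vector; _∷_; tail)
open import Data.Product using (Σ; _,_; proj₁; proj₂)
open import Data.Sum as Sum using (_⊎_; inj₁; inj₂)
open import Relation.Nullary using (¬_; Dec; yes; no; contradiction)
open import Relation.Nullary.Negation using (¬¬-Monad; ¬¬-map)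
open import Relation.Nullary.Decidable using (decidable-stable; ¬¬-excluded-middle)
open import Relation.Binary.PropositionalEquality
open import Relation.Binary.Structures using (IsTotalOrder)
open import Algebra.Bundles using (CommutativeRing)
open import Effect.Monad using (RawMonad)

open RawMonad (¬¬-Monad {0ℓ}) using (pure; _<$>_; _>>=_)

¬¬-∀-Fin : ∀ {k} {P : Fin k → Set} → (∀ i → ¬ ¬ P i) → ¬ ¬ (∀ i → P i)
¬¬-∀-Fin {zero}  _     = pure (λ ())
¬¬-∀-Fin {suc k} ¬¬P = do
  P₀ ← ¬¬P zero
  P₊ ← ¬¬-∀-Fin (¬¬P ∘ suc)
  pure λ { zero → P₀ ; (suc i) → P₊ i }

module _ (ℝ : RealField) where
  open RealField ℝ renaming (_≤_ to _≤ᵣ_; +-mono-≤ to +-monoˡ-≤)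

  ringℝ : CommutativeRing 0ℓ 0ℓ
  ringℝ = record { isCommutativeRing = isCommutativeRing }

  open CommutativeRing ringℝ
    using (+-assoc; +-comm; +-identityˡ; +-identityʳ; -‿inverseʳ; *-comm; *-assoc; *-identityˡ;
           zeroˡ; zeroʳ; distribˡ; semiring; commutativeSemiring; +-commutativeMonoid; +-abelianGroup; ring)
  open import Algebra.Properties.Ring ring using (-1*x≈-x; -‿involutive; -‿distribˡ-*)
  open import Algebra.Properties.AbelianGroup +-abelianGroup
    using (x∙y⁻¹≈ε⇒x≈y; //-rightDividesˡ; //-rightDividesʳ)
  open import Algebra.Properties.CommutativeMonoid.Sum +-commutativeMonoid
    using (sum; sum-syntax; sum-cong-≗; ∑-distrib-+; ∑-comm; sum-replicate-zero)
  open import Algebra.Properties.Semiring.Sum semiring using (*-distribˡ-sum; *-distribʳ-sum)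
  open import Algebra.Solver.Ring.NaturalCoefficients.Default commutativeSemiring using (solve; _:+_; _:*_; _:=_)
  open IsTotalOrder isTotalOrder using (total; antisym; reflexive) renaming (trans to ≤-trans)

  x*y≢0 : ∀ {x y} → x ≢ 0# → y ≢ 0# → x * y ≢ 0#
  x*y≢0 {x} {y} x≢0 y≢0 xy≡0 with inverse x x≢0
  ... | x⁻¹ , xx⁻¹≡1 = y≢0 (begin
    y              ≡⟨ sym (*-identityˡ y) ⟩
    1# * y         ≡⟨ cong (_* y) (trans (sym xx⁻¹≡1) (*-comm x x⁻¹)) ⟩
    x⁻¹ * x * y    ≡⟨ *-assoc x⁻¹ x y ⟩
    x⁻¹ * (x * y)  ≡⟨ cong (x⁻¹ *_) xy≡0 ⟩
    x⁻¹ * 0#       ≡⟨ zeroʳ x⁻¹ ⟩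
    0#             ∎)
    where open ≡-Reasoning

  x+y≡0∧x≡0⇒y≡0 : ∀ {x y} → x + y ≡ 0# → x ≡ 0# → y ≡ 0#
  x+y≡0∧x≡0⇒y≡0 {x} {y} x+y≡0 x≡0 = trans (sym (+-identityˡ y)) (trans (cong (_+ y) (sym x≡0)) x+y≡0)

  x+y≡0∧y≡0⇒x≡0 : ∀ {x y} → x + y ≡ 0# → y ≡ 0# → x ≡ 0#
  x+y≡0∧y≡0⇒x≡0 {x} {y} x+y≡0 y≡0 = trans (sym (+-identityʳ x)) (trans (cong (x +_) (sym y≡0)) x+y≡0)

  +-mono-≤ : ∀ {x y u v} → x ≤ᵣ y → u ≤ᵣ v → x + u ≤ᵣ y + v
  +-mono-≤ {x} {y} {u} {v} x≤y u≤v =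
    ≤-trans (+-monoˡ-≤ x y u x≤y) (subst₂ _≤ᵣ_ (+-comm u y) (+-comm v y) (+-monoˡ-≤ u v y u≤v))

  +-cancelʳ-≤ : ∀ z {x y} → x + z ≤ᵣ y + z → x ≤ᵣ y
  +-cancelʳ-≤ z {x} {y} x+z≤y+z =
    subst₂ _≤ᵣ_ (//-rightDividesʳ z x) (//-rightDividesʳ z y) (+-monoˡ-≤ _ _ (- z) x+z≤y+z)

  0≤1 : 0# ≤ᵣ 1#
  0≤1 with total 0# 1#
  ... | inj₁ 0≤1 = 0≤1
  ... | inj₂ 1≤0 = subst (0# ≤ᵣ_) -1*-1≡1 (*-nonneg (- 1#) (- 1#) 0≤-1 0≤-1)
    where
    0≤-1 : 0# ≤ᵣ - 1#
    0≤-1 = subst₂ _≤ᵣ_ (-‿inverseʳ 1#) (+-identityˡ (- 1#)) (+-monoˡ-≤ _ _ (- 1#) 1≤0)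
    -1*-1≡1 : - 1# * - 1# ≡ 1#
    -1*-1≡1 = trans (-1*x≈-x (- 1#)) (-‿involutive 1#)

  1≰0 : ¬ 1# ≤ᵣ 0#
  1≰0 = 0≢1 ∘ antisym 0≤1

  -- S is closed under z ↦ z + x, so its supremum s satisfies s + x ≤ s.
  ≤0-stable : ∀ x → ¬ ¬ (x ≤ᵣ 0#) → x ≤ᵣ 0#
  ≤0-stable x ¬¬x≤0 =
    +-cancelʳ-≤ s (subst₂ _≤ᵣ_ (+-comm s x) (trans (//-rightDividesˡ x s) (sym (+-identityˡ s)))
                    (+-monoˡ-≤ _ _ x s≤s-x))
    where
    S : R → Set
    S z = z ≤ᵣ 1# × ¬ ¬ (z ≤ᵣ 0#)

    S-+x : ∀ z → S z → S (z + x)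
    S-+x z (_ , ¬¬z≤0) = z+x≤1 , ¬¬z+x≤0
      where
      ¬¬z+x≤0 : ¬ ¬ (z + x ≤ᵣ 0#)
      ¬¬z+x≤0 = do
        z≤0 ← ¬¬z≤0
        x≤0 ← ¬¬x≤0
        pure (subst (z + x ≤ᵣ_) (+-identityʳ 0#) (+-mono-≤ z≤0 x≤0))

      z+x≤1 : z + x ≤ᵣ 1#
      z+x≤1 with total (z + x) 1#
      ... | inj₁ z+x≤1 = z+x≤1
      ... | inj₂ 1≤z+x = contradiction (1≰0 ∘ ≤-trans 1≤z+x) ¬¬z+x≤0

    supremum : Σ R λ s → (∀ z → S z → z ≤ᵣ s) × (∀ b → (∀ z → S z → z ≤ᵣ b) → s ≤ᵣ b)
    supremum = complete S (0# , 0≤1 , λ ¬0≤0 → ¬0≤0 (reflexive refl)) (1# , λ _ → proj₁)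

    s : R
    s = proj₁ supremum

    s-upper : ∀ z → S z → z ≤ᵣ s
    s-upper = proj₁ (proj₂ supremum)

    s-least : ∀ b → (∀ z → S z → z ≤ᵣ b) → s ≤ᵣ b
    s-least = proj₂ (proj₂ supremum)

    s≤s-x : s ≤ᵣ s + - x
    s≤s-x = s-least (s + - x) λ z Sz →
      +-cancelʳ-≤ x (subst (z + x ≤ᵣ_) (sym (//-rightDividesˡ x s)) (s-upper (z + x) (S-+x z Sz)))

  ≤-stable : ∀ x y → ¬ ¬ (x ≤ᵣ y) → x ≤ᵣ y
  ≤-stable x y ¬¬x≤y = subst₂ _≤ᵣ_ (//-rightDividesˡ y x) (+-identityˡ y) (+-monoˡ-≤ _ _ y x-y≤0)
    where
    x-y≤0 : x + - y ≤ᵣ 0#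
    x-y≤0 = ≤0-stable (x + - y)
              (¬¬-map (subst (x + - y ≤ᵣ_) (-‿inverseʳ y) ∘ +-monoˡ-≤ x y (- y)) ¬¬x≤y)

  ≡-stable : ∀ {x y} → ¬ ¬ (x ≡ y) → x ≡ y
  ≡-stable {x} {y} ¬¬x≡y = antisym (≤-stable x y (¬¬-map reflexive ¬¬x≡y))
                                   (≤-stable y x (¬¬-map (reflexive ∘ sym) ¬¬x≡y))

  ⟨_,_⟩ : ∀ {D} → Vector R D → Vector R D → R
  ⟨_,_⟩ {D} u v = ∑[ l < D ] (u l * v l)

  ⟨⟩-comm : ∀ {D} (u v : Vector R D) → ⟨ u , v ⟩ ≡ ⟨ v , u ⟩
  ⟨⟩-comm u v = sum-cong-≗ (λ l → *-comm (u l) (v l))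

  ⟨⟩-tail : ∀ {D} (u v : Vector R (suc D)) → v zero ≡ 0# → ⟨ u , v ⟩ ≡ ⟨ tail u , tail v ⟩
  ⟨⟩-tail u v v₀≡0 = begin
    u zero * v zero + ⟨ tail u , tail v ⟩  ≡⟨ cong (λ z → u zero * z + ⟨ tail u , tail v ⟩) v₀≡0 ⟩
    u zero * 0# + ⟨ tail u , tail v ⟩      ≡⟨ cong (_+ ⟨ tail u , tail v ⟩) (zeroʳ (u zero)) ⟩
    0# + ⟨ tail u , tail v ⟩               ≡⟨ +-identityˡ _ ⟩
    ⟨ tail u , tail v ⟩                    ∎
    where open ≡-Reasoning

  ⟨⟩-linearʳ : ∀ {D} (u g h : Vector R D) α β →
               ⟨ u , (λ l → α * g l + β * h l) ⟩ ≡ α * ⟨ u , g ⟩ + β * ⟨ u , h ⟩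
  ⟨⟩-linearʳ {D} u g h α β = begin
    ∑[ l < D ] (u l * (α * g l + β * h l))
      ≡⟨ sum-cong-≗ (λ l → distributes (u l) (g l) (h l)) ⟩
    ∑[ l < D ] (α * (u l * g l) + β * (u l * h l))
      ≡⟨ ∑-distrib-+ (λ l → α * (u l * g l)) (λ l → β * (u l * h l)) ⟩
    ∑[ l < D ] (α * (u l * g l)) + ∑[ l < D ] (β * (u l * h l))
      ≡⟨ sym (cong₂ _+_ (*-distribˡ-sum α (λ l → u l * g l)) (*-distribˡ-sum β (λ l → u l * h l))) ⟩
    α * ⟨ u , g ⟩ + β * ⟨ u , h ⟩ ∎
    where
    open ≡-Reasoning
    distributes : ∀ x y z → x * (α * y + β * z) ≡ α * (x * y) + β * (x * z)
    distributes = solve 5 (λ a b x y z → x :* (a :* y :+ b :* z) := a :* (x :* y) :+ b :* (x :* z)) refl α β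

  sum-↑ : ∀ a b (f : Vector R (a ℕ.+ b)) → sum f ≡ ∑[ i < a ] f (i ↑ˡ b) + ∑[ j < b ] f (a ↑ʳ j)
  sum-↑ zero    b f = sym (+-identityˡ _)
  sum-↑ (suc a) b f = trans (cong (f zero +_) (sum-↑ a b (tail f))) (sym (+-assoc _ _ _))

  sum-combine : ∀ a b (f : Vector R (a ℕ.* b)) → sum f ≡ ∑[ i < a ] ∑[ j < b ] f (combine i j)
  sum-combine zero    b f = refl
  sum-combine (suc a) b f =
    trans (sum-↑ b (a ℕ.* b) f) (cong (∑[ j < b ] f (j ↑ˡ a ℕ.* b) +_) (sum-combine a b (λ x → f (b ↑ʳ x))))

  _⊗_ : ∀ {a b} → Vector R a → Vector R b → Vector R (a ℕ.* b)
  (_⊗_ {a} {b} u v) x = u (proj₁ (remQuot {a} b x)) * v (proj₂ (remQuot {a} b x))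

  ⊗-combine : ∀ {a b} (u : Vector R a) (v : Vector R b) i j → (u ⊗ v) (combine i j) ≡ u i * v j
  ⊗-combine u v i j = cong (λ (i′ , j′) → u i′ * v j′) (remQuot-combine i j)

  ⟨⊗⟩ : ∀ {a b} (u u′ : Vector R a) (v v′ : Vector R b) →
        ⟨ u ⊗ v , u′ ⊗ v′ ⟩ ≡ ⟨ u , u′ ⟩ * ⟨ v , v′ ⟩
  ⟨⊗⟩ {a} {b} u u′ v v′ = begin
    ⟨ u ⊗ v , u′ ⊗ v′ ⟩
      ≡⟨ sum-combine a b _ ⟩
    ∑[ i < a ] ∑[ j < b ] ((u ⊗ v) (combine i j) * (u′ ⊗ v′) (combine i j))
      ≡⟨ sum-cong-≗ (λ i → sum-cong-≗ λ j → cong₂ _*_ (⊗-combine u v i j) (⊗-combine u′ v′ i j)) ⟩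
    ∑[ i < a ] ∑[ j < b ] ((u i * v j) * (u′ i * v′ j))
      ≡⟨ sum-cong-≗ (λ i → sum-cong-≗ (λ j → regroup (u i) (v j) (u′ i) (v′ j))) ⟩
    ∑[ i < a ] ∑[ j < b ] ((u i * u′ i) * (v j * v′ j))
      ≡⟨ sum-cong-≗ (λ i → sym (*-distribˡ-sum (u i * u′ i) (λ j → v j * v′ j))) ⟩
    ∑[ i < a ] ((u i * u′ i) * ⟨ v , v′ ⟩)
      ≡⟨ sym (*-distribʳ-sum ⟨ v , v′ ⟩ (λ i → u i * u′ i)) ⟩
    ⟨ u , u′ ⟩ * ⟨ v , v′ ⟩ ∎
    where
    open ≡-Reasoning
    regroup : ∀ x y x′ y′ → (x * y) * (x′ * y′) ≡ (x * x′) * (y * y′)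
    regroup = solve 4 (λ x y x′ y′ → (x :* y) :* (x′ :* y′) := (x :* x′) :* (y :* y′)) refl

  IsBiorthogonal : ∀ {k D} → (u w : Fin k → Vector R D) → Set
  IsBiorthogonal u w = (∀ t → ⟨ u t , w t ⟩ ≢ 0#) × (∀ s t → s ≢ t → ⟨ u s , w t ⟩ ≡ 0#)

  biorthogonal-tail : ∀ {k D} (u w : Fin k → Vector R (suc D)) → (∀ t → w t zero ≡ 0#) →
                      IsBiorthogonal u w → IsBiorthogonal (tail ∘ u) (tail ∘ w)
  biorthogonal-tail u w w₀≡0 (diag , off) =
    (λ t → diag t ∘ trans (⟨⟩-tail (u t) (w t) (w₀≡0 t))) ,
    (λ s t s≢t → trans (sym (⟨⟩-tail (u s) (w t) (w₀≡0 t))) (off s t s≢t))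

  eliminate : ∀ {D} → Vector R (suc D) → Vector R (suc D) → Vector R (suc D)
  eliminate p v l = p zero * v l + - v zero * p l

  eliminate-zero : ∀ {D} (p v : Vector R (suc D)) → eliminate p v zero ≡ 0#
  eliminate-zero p v = trans (cong₂ _+_ (*-comm (p zero) (v zero)) (sym (-‿distribˡ-* (v zero) (p zero))))
                             (-‿inverseʳ _)

  biorthogonal-eliminate : ∀ {k D} (u w : Fin (suc k) → Vector R (suc D)) t₀ → w t₀ zero ≢ 0# →
                           IsBiorthogonal u w →
                           IsBiorthogonal (λ s → tail (u (punchIn t₀ s)))
                                          (λ t → tail (eliminate (w t₀) (w (punchIn t₀ t))))
  biorthogonal-eliminate u w t₀ pivot≢0 (diag , off) =
    (λ t → x*y≢0 pivot≢0 (diag (punchIn t₀ t)) ∘ trans (sym (reduced t t))) ,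
    (λ s t s≢t → trans (reduced s t)
                   (trans (cong (c *_) (off _ _ (s≢t ∘ punchIn-injective t₀ s t))) (zeroʳ c)))
    where
    c : R
    c = w t₀ zero

    reduced : ∀ s t → ⟨ tail (u (punchIn t₀ s)) , tail (eliminate (w t₀) (w (punchIn t₀ t))) ⟩
                      ≡ c * ⟨ u (punchIn t₀ s) , w (punchIn t₀ t) ⟩
    reduced s t = begin
      ⟨ tail uₛ , tail (eliminate (w t₀) wₜ) ⟩
        ≡⟨ sym (⟨⟩-tail uₛ (eliminate (w t₀) wₜ) (eliminate-zero (w t₀) wₜ)) ⟩
      ⟨ uₛ , eliminate (w t₀) wₜ ⟩
        ≡⟨ ⟨⟩-linearʳ uₛ wₜ (w t₀) c (- wₜ zero) ⟩
      c * ⟨ uₛ , wₜ ⟩ + - wₜ zero * ⟨ uₛ , w t₀ ⟩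
        ≡⟨ cong (λ z → c * ⟨ uₛ , wₜ ⟩ + - wₜ zero * z) (off _ t₀ (punchInᵢ≢i t₀ s)) ⟩
      c * ⟨ uₛ , wₜ ⟩ + - wₜ zero * 0#
        ≡⟨ trans (cong (c * ⟨ uₛ , wₜ ⟩ +_) (zeroʳ _)) (+-identityʳ _) ⟩
      c * ⟨ uₛ , wₜ ⟩ ∎
      where
      open ≡-Reasoning
      uₛ wₜ : Vector R (suc _)
      uₛ = u (punchIn t₀ s)
      wₜ = w (punchIn t₀ t)

  -- Gaussian elimination; whether some w t has a nonzero first coordinate is only decidable
  -- classically, hence the double negation.
  biorthogonal⇒≤ : ∀ {k D} (u w : Fin k → Vector R D) → IsBiorthogonal u w → ¬ ¬ (k ≤ D)
  biorthogonal⇒≤ {zero}          u w _           = pure z≤n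
  biorthogonal⇒≤ {suc k} {zero}  u w (diag , _)  = contradiction refl (diag zero)
  biorthogonal⇒≤ {suc k} {suc D} u w uw = do
    pivot? ← ¬¬-excluded-middle
    case pivot?
    where
    case : Dec (Σ (Fin (suc k)) λ t → w t zero ≢ 0#) → ¬ ¬ (suc k ≤ suc D)
    case (yes (t₀ , pivot≢0)) = s≤s <$> biorthogonal⇒≤ _ _ (biorthogonal-eliminate u w t₀ pivot≢0 uw)
    case (no no-pivot) = m≤n⇒m≤1+n <$> biorthogonal⇒≤ _ _
      (biorthogonal-tail u w (λ t → ≡-stable (λ w₀≢0 → no-pivot (t , w₀≢0))) uw)

  -- A fooling set in the matrix (⟨ x s , y t ⟩) becomes a biorthogonal system
  -- after passing to the Hadamard product of the matrix with its transpose.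
  fooling-set≤rank² : ∀ {k D} (x y : Fin k → Vector R D) →
                      (∀ t → ⟨ x t , y t ⟩ ≢ 0#) →
                      (∀ s t → s ≢ t → ⟨ x s , y t ⟩ ≡ 0# ⊎ ⟨ x t , y s ⟩ ≡ 0#) →
                      ¬ ¬ (k ≤ D ℕ.* D)
  fooling-set≤rank² x y diag fooling =
    biorthogonal⇒≤ (λ s → x s ⊗ y s) (λ t → y t ⊗ x t)
      ((λ t → x*y≢0 (diag t) (diag t) ∘ trans (sym (hadamard t t))) ,
       (λ s t s≢t → trans (hadamard s t) (Sum.[ product≡0ˡ , product≡0ʳ ] (fooling s t s≢t))))
    where
    hadamard : ∀ s t → ⟨ x s ⊗ y s , y t ⊗ x t ⟩ ≡ ⟨ x s , y t ⟩ * ⟨ x t , y s ⟩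
    hadamard s t = trans (⟨⊗⟩ (x s) (y t) (y s) (x t)) (cong (⟨ x s , y t ⟩ *_) (⟨⟩-comm (y s) (x t)))
    product≡0ˡ : ∀ {a b} → a ≡ 0# → a * b ≡ 0#
    product≡0ˡ {b = b} refl = zeroˡ b
    product≡0ʳ : ∀ {a b} → b ≡ 0# → a * b ≡ 0#
    product≡0ʳ {a} refl = zeroʳ a

  open Geometry ℝ

  ∑≡sum : ∀ k (f : Fin k → R) → ∑ k f ≡ sum f
  ∑≡sum zero    f = refl
  ∑≡sum (suc k) f = cong (f zero +_) (∑≡sum k (tail f))

  IsAffineDependency : ∀ {n k} → (Fin k → Point n) → (Fin k → R) → Set
  IsAffineDependency {n} {k} q μ = ∑ k μ ≡ 0# × (∀ c → ∑ k (λ i → μ i * q i c) ≡ 0#)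

  affine-dependency-annihilates : ∀ {n k} (q : Fin k → Point n) μ → IsAffineDependency q μ →
                                  ∀ a β → ∑ k (λ i → μ i * (a · q i + β)) ≡ 0#
  affine-dependency-annihilates {n} {k} q μ (∑μ≡0 , ∑μq≡0) a β = begin
    ∑ k (λ i → μ i * (a · q i + β))
      ≡⟨ ∑≡sum k _ ⟩
    ∑[ i < k ] (μ i * (a · q i + β))
      ≡⟨ sum-cong-≗ (λ i → distribˡ (μ i) (a · q i) β) ⟩
    ∑[ i < k ] (μ i * (a · q i) + μ i * β)
      ≡⟨ ∑-distrib-+ (λ i → μ i * (a · q i)) (λ i → μ i * β) ⟩
    ∑[ i < k ] (μ i * (a · q i)) + ∑[ i < k ] (μ i * β)
      ≡⟨ cong₂ _+_ linear-part constant-part ⟩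
    0# + 0#
      ≡⟨ +-identityˡ 0# ⟩
    0# ∎
    where
    open ≡-Reasoning
    ∑μq≡0′ : ∀ c → ∑[ i < k ] (μ i * q i c) ≡ 0#
    ∑μq≡0′ c = trans (sym (∑≡sum k _)) (∑μq≡0 c)

    linear-part : ∑[ i < k ] (μ i * (a · q i)) ≡ 0#
    linear-part = begin
      ∑[ i < k ] (μ i * (a · q i))
        ≡⟨ sum-cong-≗ (λ i → cong (μ i *_) (∑≡sum n _)) ⟩
      ∑[ i < k ] (μ i * ∑[ c < n ] (a c * q i c))
        ≡⟨ sum-cong-≗ (λ i → *-distribˡ-sum (μ i) (λ c → a c * q i c)) ⟩
      ∑[ i < k ] ∑[ c < n ] (μ i * (a c * q i c))
        ≡⟨ ∑-comm (λ i c → μ i * (a c * q i c)) ⟩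
      ∑[ c < n ] ∑[ i < k ] (μ i * (a c * q i c))
        ≡⟨ sum-cong-≗ (λ c → sum-cong-≗ (λ i → swap (μ i) (a c) (q i c))) ⟩
      ∑[ c < n ] ∑[ i < k ] (a c * (μ i * q i c))
        ≡⟨ sum-cong-≗ (λ c → sym (*-distribˡ-sum (a c) (λ i → μ i * q i c))) ⟩
      ∑[ c < n ] (a c * ∑[ i < k ] (μ i * q i c))
        ≡⟨ sum-cong-≗ (λ c → trans (cong (a c *_) (∑μq≡0′ c)) (zeroʳ (a c))) ⟩
      ∑[ c < n ] 0#
        ≡⟨ sum-replicate-zero n ⟩
      0# ∎
      where
      swap : ∀ x y z → x * (y * z) ≡ y * (x * z)
      swap = solve 3 (λ x y z → x :* (y :* z) := y :* (x :* z)) refl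

    constant-part : ∑[ i < k ] (μ i * β) ≡ 0#
    constant-part = trans (sym (*-distribʳ-sum β μ))
                          (trans (cong (_* β) (trans (sym (∑≡sum k μ)) ∑μ≡0)) (zeroˡ β))

  ∷-dependency-annihilates : ∀ {n e} (p : Fin e → Point n) y μ → IsAffineDependency (y ∷ p) μ →
                             ∀ a β → μ zero * (a · y + β) + ⟨ tail μ , (λ l → a · p l + β) ⟩ ≡ 0#
  ∷-dependency-annihilates {e = e} p y μ dep a β =
    trans (cong (μ zero * (a · y + β) +_) (sym (∑≡sum e _))) (affine-dependency-annihilates (y ∷ p) μ dep a β)

  ∷-dependency-trivial : ∀ {n e} (p : Fin e → Point n) → AffInd p →
                         ∀ y μ → IsAffineDependency (y ∷ p) μ → μ zero ≡ 0# → ∀ i → μ i ≡ 0#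
  ∷-dependency-trivial p p-indep y μ (∑μ≡0 , ∑μq≡0) μ₀≡0 zero    = μ₀≡0
  ∷-dependency-trivial p p-indep y μ (∑μ≡0 , ∑μq≡0) μ₀≡0 (suc l) =
    p-indep (tail μ) (x+y≡0∧x≡0⇒y≡0 ∑μ≡0 μ₀≡0)
      (λ c → x+y≡0∧x≡0⇒y≡0 (∑μq≡0 c) (trans (cong (_* y c) μ₀≡0) (zeroˡ (y c)))) l

  ¬AffInd⇒pivoted-dependency : ∀ {n e} (p : Fin e → Point n) → AffInd p → ∀ y → ¬ AffInd (y ∷ p) →
                               ¬ ¬ Σ (Fin (suc e) → R) λ μ → IsAffineDependency (y ∷ p) μ × μ zero ≢ 0#
  ¬AffInd⇒pivoted-dependency p p-indep y ¬indep none = ¬indep λ μ ∑μ≡0 ∑μq≡0 i →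
    ≡-stable λ μᵢ≢0 → none (μ , (∑μ≡0 , ∑μq≡0) ,
      λ μ₀≡0 → μᵢ≢0 (∷-dependency-trivial p p-indep y μ (∑μ≡0 , ∑μq≡0) μ₀≡0 i))

  slack : ∀ {n m} {V : Fin m → Point n} → Face V → Point n → R
  slack ((a , b) , _) x = a · x + - b

  InFace⇒slack≡0 : ∀ {n m} {V : Fin m → Point n} (F : Face V) {x} → InFace F x → slack F x ≡ 0#
  InFace⇒slack≡0 F (_ , a·x≡b) = trans (cong (_+ _) a·x≡b) (-‿inverseʳ _)

  separating-point : ∀ {n m} {V : Fin m → Point n} (F G : Face V) → ¬ Contains F G →
                     ¬ ¬ Σ (Point n) λ y → InFace G y × slack F y ≢ 0#
  separating-point F G G⊈F none = G⊈F λ x x∈G →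
    proj₁ x∈G , ≡-stable (λ a·x≢b → none (x , x∈G , a·x≢b ∘ x∙y⁻¹≈ε⇒x≈y _ _))

  polytope-fooling-set≤ : ∀ {n m d} (V : Fin m → Point n) → PolytopeDim V d →
                          ∀ {r c} (M : NonIncidenceMatrix V d r c) {k} (f : Fin k → Fin r × Fin c) →
                          IsFoolingSet (NonIncidenceMatrix.Zero M) f → ¬ ¬ (k ≤ suc d ℕ.* suc d)
  polytope-fooling-set≤ {n} {d = d} V ((p , p∈P , p-indep) , maximal) M {k} f (_ , f-nonzero , f-fooling) = do
    W ← ¬¬-∀-Fin witness
    fooling-set≤rank² (λ t → tail (coeff (W t))) (λ s → slack (F s) ∘ p) (diag W) (off W)
    where
    open NonIncidenceMatrix M

    F : Fin k → Face V
    F s = row (proj₁ (f s))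

    G : Fin k → Face V
    G t = col (proj₂ (f t))

    record Witness (t : Fin k) : Set where
      field
        point      : Point n
        point∈G    : InFace (G t) point
        slack≢0    : slack (F t) point ≢ 0#
        coeff      : Fin (suc (suc d)) → R
        dependency : IsAffineDependency (point ∷ p) coeff
        pivot≢0    : coeff zero ≢ 0#
    open Witness

    witness : ∀ t → ¬ ¬ Witness t
    witness t = do
      (y , y∈G , slack≢0) ← separating-point (F t) (G t) (f-nonzero t)
      (μ , dep , μ₀≢0) ← ¬AffInd⇒pivoted-dependency p p-indep y
                            (maximal (y ∷ p) λ { zero → proj₁ y∈G ; (suc l) → p∈P l })
      pure record { point = y ; point∈G = y∈G ; slack≢0 = slack≢0
                  ; coeff = μ ; dependency = dep ; pivot≢0 = μ₀≢0 }

    module _ (W : ∀ t → Witness t) where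
      entry : Fin k → Fin k → R
      entry s t = ⟨ tail (coeff (W t)) , slack (F s) ∘ p ⟩

      entry-identity : ∀ s t → coeff (W t) zero * slack (F s) (point (W t)) + entry s t ≡ 0#
      entry-identity s t = ∷-dependency-annihilates p (point (W t)) (coeff (W t)) (dependency (W t)) _ _

      diag : ∀ t → entry t t ≢ 0#
      diag t entry≡0 =
        x*y≢0 (pivot≢0 (W t)) (slack≢0 (W t)) (x+y≡0∧y≡0⇒x≡0 (entry-identity t t) entry≡0)

      entry≡0 : ∀ s t → Zero (proj₁ (f s)) (proj₂ (f t)) → entry s t ≡ 0#
      entry≡0 s t F⊇G = x+y≡0∧x≡0⇒y≡0 (entry-identity s t)
        (trans (cong (coeff (W t) zero *_) (InFace⇒slack≡0 (F s) (F⊇G _ (point∈G (W t))))) (zeroʳ _))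

      off : ∀ s t → s ≢ t → entry t s ≡ 0# ⊎ entry s t ≡ 0#
      off s t s≢t = Sum.swap (Sum.map (entry≡0 s t) (entry≡0 t s) (f-fooling s t s≢t))

lemma5p7 : (ℝ : RealField) {n m d : ℕ} (V : Fin m → Geometry.Point ℝ n) →
    Geometry.PolytopeDim ℝ V d →
    {r c : ℕ} (M : Geometry.NonIncidenceMatrix ℝ V d r c) →
    {k : ℕ} (f : Fin k → Fin r × Fin c) →
    IsFoolingSet (Geometry.NonIncidenceMatrix.Zero M) f →
    k ≤ suc d ^ 2
lemma5p7 ℝ {d = d} V dimP M {k} f fooling =
  subst (k ≤_) (cong (suc d ℕ.*_) (sym (*-identityʳ (suc d))))
    (decidable-stable (k ≤? suc d ℕ.* suc d) (polytope-fooling-set≤ ℝ V dimP M f fooling))
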